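{- Let $k,n,s$ be positive integers and let $x_1,\dots,x_n$ be independent variables. Then \[ h_k(x_1^{s+1},\ldots,x_n^{s+1})=\sum_{j=0}^{k(s+1)} (-1)^{j} h_j(x_1,\ldots,x_n)\, M_{k(s+1)-j}^{(s)}(x_1,\ldots,x_n) \] and \[ e_k(x_1,\ldots,x_n)=\sum_{j=0}^{\lfloor k/(s+1) \rfloor} (-1)^{j} e_j(x_1^{s+1},\ldots,x_n^{s+1})\, M_{k-j(s+1)}^{(s)}(x_1,\ldots,x_n). \] Moreover, if $k\not\equiv 0 \pmod{s+1}$, then \[ \sum_{j=0}^k (-1)^j h_j(x_1,\ldots,x_n)\, M_{k-j}^{(s)}(x_1,\ldots,x_n) = 0. \]
   Context: $M_{m}^{(s)}(x_{1},\ldots,x_{n})=\sum x_{1}^{a_{1}}\cdots x_{n}^{a_{n}}$, the sum over all $n$-tuples of nonnegative integers with $a_1+\cdots+a_n=m$ and each $a_i\equiv 0$ or $1 \pmod{s+1}$. $h_j$ and $e_j$ denote the complete homogeneous and elementary symmetric polynomials of degree $j$ (with $h_0=e_0=1$, $e_j=0$ for $j>n$). -}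

module Defs where

open import Level using (Level)
open import Data.Bool using (Bool; true; false; if_then_else_; _∨_)
open import Data.Nat using (ℕ; zero; suc; _∸_; _≡ᵇ_; _≤ᵇ_; _%_)
open import Data.Vec using (Vec; []; _∷_; map)
open import Algebra.Bundles using (CommutativeRing)

module Poly {c ℓ : Level} (R : CommutativeRing c ℓ) where
  open CommutativeRing R

  pow : Carrier → ℕ → Carrier
  pow x zero    = 1#
  pow x (suc a) = x * pow x a

  Σ≤ : ℕ → (ℕ → Carrier) → Carrier
  Σ≤ zero    f = f 0
  Σ≤ (suc N) f = Σ≤ N f + f (suc N)

  signed : ℕ → Carrier → Carrier
  signed zero    y = y
  signed (suc j) y = - signed j y

  -- Sum of x₁^a₁ ⋯ xₙ^aₙ over all n-tuples (a₁,…,aₙ) of nonnegative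
  -- integers with a₁+⋯+aₙ = m and P aᵢ = true for every i.
  -- (Defined by recursion on the number of variables: a₁ ranges over 0..m.)
  tupleSum : (ℕ → Bool) → ℕ → {n : ℕ} → Vec Carrier n → Carrier
  tupleSum P m []       = if m ≡ᵇ 0 then 1# else 0#
  tupleSum P m (x ∷ xs) =
    Σ≤ m (λ a → if P a then pow x a * tupleSum P (m ∸ a) xs else 0#)

  h : ℕ → {n : ℕ} → Vec Carrier n → Carrier
  h j xs = tupleSum (λ _ → true) j xs

  e : ℕ → {n : ℕ} → Vec Carrier n → Carrier
  e j xs = tupleSum (λ a → a ≤ᵇ 1) j xs

  M : (s : ℕ) → ℕ → {n : ℕ} → Vec Carrier n → Carrier
  M s m xs = tupleSum (λ a → ((a % suc s) ≡ᵇ 0) ∨ ((a % suc s) ≡ᵇ 1)) m xs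

  powVec : (s : ℕ) → {n : ℕ} → Vec Carrier n → Vec Carrier n
  powVec s xs = map (λ x → pow x (suc s)) xs

-- Writing H(t) = ∏ 1/(1 − xᵢt), E(t) = ∏ (1 + xᵢt) and d = s + 1, the exponents
-- a ≡ 0, 1 (mod d) are exactly qd and qd + 1 (as s ≥ 1), so  Σₘ M⁽ˢ⁾ₘ tᵐ = ∏ (1 + xᵢt)/(1 − xᵢᵈtᵈ).
-- Hence H(−t)·M(t) = ∏ 1/(1 − xᵢᵈtᵈ) = H(x₁ᵈ,…,xₙᵈ; tᵈ) and E(x₁ᵈ,…,xₙᵈ; −tᵈ)·M(t) = E(t);
-- comparing coefficients of t^{kd} and tᵏ gives the three identities. Both substitutions
-- t ↦ −t and t ↦ tᵈ are multiplicative, so they commute with the product over the variables.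

module Submission where

open import Defs
open import Level using (Level)
open import Function using (_∘_)
open import Data.Bool using (Bool; true; false; if_then_else_; _∨_)
open import Data.Nat using (ℕ; zero; suc; z≤n; s≤s; _≤_; _<_; _/_; _%_; _≡ᵇ_; _≤ᵇ_)
  renaming (_+_ to _+ℕ_; _*_ to _*ℕ_; _∸_ to _∸ℕ_)
import Data.Nat.Properties as ℕ
open import Data.Nat.DivMod
  using (m≡m%n+[m/n]*n; m*n%n≡0; m*n/n≡m; m<n⇒m%n≡m; m%n<n; n%n≡0; %-distribˡ-+)
open import Data.Nat.Divisibility
  using (_∣_; divides; _∣?_; ∣⇒≤; ∣m+n∣m⇒∣n; ∣m∣n⇒∣m+n; n∣m*n; m%n≡0⇒n∣m; n∣m⇒m%n≡0)
open import Data.Vec using (Vec; []; _∷_; map)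
open import Data.Product using (_×_; _,_)
open import Data.Empty using (⊥-elim)
open import Relation.Nullary using (¬_; yes; no)
open import Relation.Binary.Bundles using (Setoid)
open import Relation.Binary.Structures using (IsEquivalence)
import Relation.Binary.Reasoning.Setoid as SetoidReasoning
open import Relation.Binary.PropositionalEquality as ≡ using (_≡_; cong)
open import Algebra.Bundles using (CommutativeRing; CommutativeMonoid)
open import Algebra.Morphism.Structures using (module MonoidMorphisms)

module FiniteSums {c ℓ : Level} (R : CommutativeRing c ℓ) where
  open CommutativeRing R
  open Poly R
  open SetoidReasoning setoid
  open import Algebra.Properties.Ring ring using (-‿+-comm)
  open import Algebra.Properties.CommutativeSemigroup +-commutativeSemigroup using (interchange)

  Σ≤-cong : ∀ N {f g} → (∀ a → a ≤ N → f a ≈ g a) → Σ≤ N f ≈ Σ≤ N g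
  Σ≤-cong zero    f≈g = f≈g 0 z≤n
  Σ≤-cong (suc N) f≈g =
    +-cong (Σ≤-cong N (λ a a≤N → f≈g a (ℕ.m≤n⇒m≤1+n a≤N))) (f≈g (suc N) ℕ.≤-refl)

  Σ≤-zero : ∀ N {f} → (∀ a → a ≤ N → f a ≈ 0#) → Σ≤ N f ≈ 0#
  Σ≤-zero zero    f≈0 = f≈0 0 z≤n
  Σ≤-zero (suc N) f≈0 =
    trans (+-cong (Σ≤-zero N (λ a a≤N → f≈0 a (ℕ.m≤n⇒m≤1+n a≤N))) (f≈0 (suc N) ℕ.≤-refl))
          (+-identityʳ 0#)

  Σ≤-+ : ∀ N f g → Σ≤ N (λ a → f a + g a) ≈ Σ≤ N f + Σ≤ N g
  Σ≤-+ zero    f g = refl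
  Σ≤-+ (suc N) f g = trans (+-congʳ (Σ≤-+ N f g)) (interchange _ _ _ _)

  Σ≤-*ˡ : ∀ N x f → x * Σ≤ N f ≈ Σ≤ N (λ a → x * f a)
  Σ≤-*ˡ zero    x f = refl
  Σ≤-*ˡ (suc N) x f = trans (distribˡ x _ _) (+-congʳ (Σ≤-*ˡ N x f))

  Σ≤-neg : ∀ N f → - Σ≤ N f ≈ Σ≤ N (λ a → - f a)
  Σ≤-neg zero    f = refl
  Σ≤-neg (suc N) f = trans (sym (-‿+-comm _ _)) (+-congʳ (Σ≤-neg N f))

  Σ≤-suc : ∀ N f → Σ≤ (suc N) f ≈ f 0 + Σ≤ N (f ∘ suc)
  Σ≤-suc zero    f = refl
  Σ≤-suc (suc N) f = trans (+-congʳ (Σ≤-suc N f)) (+-assoc _ _ _)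

  Σ≤-head : ∀ N f → (∀ a → a < N → f (suc a) ≈ 0#) → Σ≤ N f ≈ f 0
  Σ≤-head zero    f _   = refl
  Σ≤-head (suc N) f f≈0 =
    trans (Σ≤-suc N f) (trans (+-congˡ (Σ≤-zero N (λ a a≤N → f≈0 a (s≤s a≤N)))) (+-identityʳ _))

  Σ≤-reverse : ∀ N f → Σ≤ N f ≈ Σ≤ N (λ a → f (N ∸ℕ a))
  Σ≤-reverse zero    f = refl
  Σ≤-reverse (suc N) f = begin
    Σ≤ N f + f (suc N)                     ≈⟨ +-congʳ (Σ≤-reverse N f) ⟩
    Σ≤ N (λ a → f (N ∸ℕ a)) + f (suc N)    ≈⟨ +-comm _ _ ⟩
    f (suc N) + Σ≤ N (λ a → f (N ∸ℕ a))    ≈⟨ Σ≤-suc N (λ a → f (suc N ∸ℕ a)) ⟨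
    Σ≤ (suc N) (λ a → f (suc N ∸ℕ a))      ∎

  Σ≤-triangle : ∀ N (G : ℕ → ℕ → Carrier) →
    Σ≤ N (λ a → Σ≤ (N ∸ℕ a) (G a)) ≈ Σ≤ N (λ b → Σ≤ (N ∸ℕ b) (λ a → G a b))
  Σ≤-triangle zero    G = refl
  Σ≤-triangle (suc N) G = begin
    Σ≤ (suc N) (λ a → Σ≤ (suc N ∸ℕ a) (G a))
      ≈⟨ Σ≤-suc N _ ⟩
    Σ≤ (suc N) (G 0) + Σ≤ N (λ a → Σ≤ (N ∸ℕ a) (G (suc a)))
      ≈⟨ +-cong (+-comm _ _) (Σ≤-triangle N (G ∘ suc)) ⟩
    (G 0 (suc N) + Σ≤ N (G 0)) + Σ≤ N (λ b → Σ≤ (N ∸ℕ b) (λ a → G (suc a) b))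
      ≈⟨ +-assoc _ _ _ ⟩
    G 0 (suc N) + (Σ≤ N (G 0) + Σ≤ N (λ b → Σ≤ (N ∸ℕ b) (λ a → G (suc a) b)))
      ≈⟨ +-congˡ (Σ≤-+ N _ _) ⟨
    G 0 (suc N) + Σ≤ N (λ b → G 0 b + Σ≤ (N ∸ℕ b) (λ a → G (suc a) b))
      ≈⟨ +-congˡ (Σ≤-cong N (λ b b≤N → sym (column b b≤N))) ⟩
    G 0 (suc N) + Σ≤ N (λ b → Σ≤ (suc N ∸ℕ b) (λ a → G a b))
      ≈⟨ +-comm _ _ ⟩
    Σ≤ N (λ b → Σ≤ (suc N ∸ℕ b) (λ a → G a b)) + G 0 (suc N)
      ≡⟨ cong (λ m → Σ≤ N (λ b → Σ≤ (suc N ∸ℕ b) (λ a → G a b)) + Σ≤ m (λ a → G a (suc N)))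
              (ℕ.n∸n≡0 N) ⟨
    Σ≤ (suc N) (λ b → Σ≤ (suc N ∸ℕ b) (λ a → G a b)) ∎
    where
    column : ∀ b → b ≤ N →
      Σ≤ (suc N ∸ℕ b) (λ a → G a b) ≈ G 0 b + Σ≤ (N ∸ℕ b) (λ a → G (suc a) b)
    column b b≤N rewrite ℕ.+-∸-assoc 1 b≤N = Σ≤-suc (N ∸ℕ b) (λ a → G a b)

module Signs {c ℓ : Level} (R : CommutativeRing c ℓ) where
  open CommutativeRing R
  open Poly R
  open FiniteSums R
  open import Algebra.Properties.Ring ring using (-‿distribˡ-*; -‿distribʳ-*; -0#≈0#)

  signed-cong : ∀ j {x y} → x ≈ y → signed j x ≈ signed j y
  signed-cong zero    x≈y = x≈y
  signed-cong (suc j) x≈y = -‿cong (signed-cong j x≈y)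

  signed-*ˡ : ∀ j x y → signed j (x * y) ≈ signed j x * y
  signed-*ˡ zero    x y = refl
  signed-*ˡ (suc j) x y = trans (-‿cong (signed-*ˡ j x y)) (-‿distribˡ-* _ _)

  signed-*ʳ : ∀ j x y → signed j (x * y) ≈ x * signed j y
  signed-*ʳ zero    x y = refl
  signed-*ʳ (suc j) x y = trans (-‿cong (signed-*ʳ j x y)) (-‿distribʳ-* _ _)

  signed-+ : ∀ i j x → signed (i +ℕ j) x ≈ signed i (signed j x)
  signed-+ zero    j x = refl
  signed-+ (suc i) j x = -‿cong (signed-+ i j x)

  signed-0# : ∀ j → signed j 0# ≈ 0#
  signed-0# zero    = refl
  signed-0# (suc j) = trans (-‿cong (signed-0# j)) -0#≈0#

  signed-Σ≤ : ∀ j N f → signed j (Σ≤ N f) ≈ Σ≤ N (λ a → signed j (f a))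
  signed-Σ≤ zero    N f = refl
  signed-Σ≤ (suc j) N f = trans (-‿cong (signed-Σ≤ j N f)) (Σ≤-neg N _)

module Powers {c ℓ : Level} (R : CommutativeRing c ℓ) where
  open CommutativeRing R
  open Poly R
  open SetoidReasoning setoid
  open import Algebra.Properties.Semiring.Exp semiring using (_^_; ^-congˡ; ^-assocʳ)

  pow≈^ : ∀ x n → pow x n ≈ x ^ n
  pow≈^ x zero    = refl
  pow≈^ x (suc n) = *-congˡ (pow≈^ x n)

  pow-pow : ∀ x m n → pow (pow x m) n ≈ pow x (n *ℕ m)
  pow-pow x m n = begin
    pow (pow x m) n  ≈⟨ pow≈^ (pow x m) n ⟩
    pow x m ^ n      ≈⟨ ^-congˡ n (pow≈^ x m) ⟩
    (x ^ m) ^ n      ≈⟨ ^-assocʳ x m n ⟩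
    x ^ (m *ℕ n)     ≡⟨ cong (x ^_) (ℕ.*-comm m n) ⟩
    x ^ (n *ℕ m)     ≈⟨ pow≈^ x (n *ℕ m) ⟨
    pow x (n *ℕ m)   ∎

module Guards {c ℓ : Level} (R : CommutativeRing c ℓ) where
  open CommutativeRing R

  guard-*ʳ : ∀ b {u v v′} → v ≈ v′ → (if b then u * v else 0#) ≈ (if b then u else 0#) * v′
  guard-*ʳ true  v≈v′ = *-congˡ v≈v′
  guard-*ʳ false _    = sym (zeroˡ _)

  *-guard : ∀ b x u → x * (if b then u else 0#) ≈ (if b then x * u else 0#)
  *-guard true  x u = refl
  *-guard false x u = zeroʳ x

  guard-∨ : ∀ t u →
    (if (t ≡ᵇ 0) ∨ (t ≡ᵇ 1) then u else 0#) ≈ (if t ≡ᵇ 0 then u else 0#) + (if t ≡ᵇ 1 then u else 0#)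
  guard-∨ zero          u = sym (+-identityʳ u)
  guard-∨ (suc zero)    u = sym (+-identityˡ u)
  guard-∨ (suc (suc t)) u = sym (+-identityˡ 0#)

module PowerSeries {c ℓ : Level} (R : CommutativeRing c ℓ) where
  open CommutativeRing R
  open Poly R
  open FiniteSums R
  open Signs R
  open Guards R
  open SetoidReasoning setoid
  open import Algebra.Properties.CommutativeSemigroup *-commutativeSemigroup using (x∙yz≈y∙xz)

  Series : Set c
  Series = ℕ → Carrier

  -- A record rather than a Π-type, so that the series of f ≋ g can be inferred from it
  -- (a partially applied _⋆_ would otherwise be η-expanded and unfolded during unification).
  infix 4 _≋_
  record _≋_ (f g : Series) : Set ℓ where
    field coeff : ∀ N → f N ≈ g N
  open _≋_ public

  infixl 7 _⋆_
  _⋆_ : Series → Series → Series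
  (f ⋆ g) N = Σ≤ N (λ a → f a * g (N ∸ℕ a))

  one : Series
  one zero    = 1#
  one (suc _) = 0#

  ≋-isEquivalence : IsEquivalence _≋_
  ≋-isEquivalence = record
    { refl  = λ where .coeff _ → refl
    ; sym   = λ f≋g → λ where .coeff N → sym (f≋g .coeff N)
    ; trans = λ f≋g g≋h → λ where .coeff N → trans (f≋g .coeff N) (g≋h .coeff N)
    }

  ⋆-cong : ∀ {f f′ g g′} → f ≋ f′ → g ≋ g′ → f ⋆ g ≋ f′ ⋆ g′
  ⋆-cong f≋f′ g≋g′ .coeff N = Σ≤-cong N (λ a _ → *-cong (f≋f′ .coeff a) (g≋g′ .coeff (N ∸ℕ a)))

  ⋆-comm : ∀ f g → f ⋆ g ≋ g ⋆ f
  ⋆-comm f g .coeff N = trans (Σ≤-reverse N _) (Σ≤-cong N (λ a a≤N →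
    trans (*-comm _ _) (*-congʳ (reflexive (cong g (ℕ.m∸[m∸n]≡n a≤N))))))

  ⋆-identityˡ : ∀ f → one ⋆ f ≋ f
  ⋆-identityˡ f .coeff N = trans (Σ≤-head N _ (λ a _ → zeroˡ _)) (*-identityˡ _)

  ⋆-identityʳ : ∀ f → f ⋆ one ≋ f
  ⋆-identityʳ f .coeff N = trans (⋆-comm f one .coeff N) (⋆-identityˡ f .coeff N)

  ⋆-assoc : ∀ f g h → (f ⋆ g) ⋆ h ≋ f ⋆ (g ⋆ h)
  ⋆-assoc f g h .coeff N = begin
    ((f ⋆ g) ⋆ h) N
      ≈⟨ ⋆-comm (f ⋆ g) h .coeff N ⟩
    Σ≤ N (λ c → h c * Σ≤ (N ∸ℕ c) (λ a → f a * g (N ∸ℕ c ∸ℕ a)))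
      ≈⟨ Σ≤-cong N (λ c _ → Σ≤-*ˡ (N ∸ℕ c) (h c) _) ⟩
    Σ≤ N (λ c → Σ≤ (N ∸ℕ c) (λ a → h c * (f a * g (N ∸ℕ c ∸ℕ a))))
      ≈⟨ Σ≤-triangle N _ ⟩
    Σ≤ N (λ a → Σ≤ (N ∸ℕ a) (λ c → h c * (f a * g (N ∸ℕ c ∸ℕ a))))
      ≈⟨ Σ≤-cong N (λ a _ → Σ≤-cong (N ∸ℕ a) (λ c _ → rearrange a c)) ⟩
    Σ≤ N (λ a → Σ≤ (N ∸ℕ a) (λ c → f a * (h c * g (N ∸ℕ a ∸ℕ c))))
      ≈⟨ Σ≤-cong N (λ a _ → trans (sym (Σ≤-*ˡ (N ∸ℕ a) (f a) _))
                                  (*-congˡ (⋆-comm h g .coeff (N ∸ℕ a)))) ⟩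
    (f ⋆ (g ⋆ h)) N ∎
    where
    rearrange : ∀ a c → h c * (f a * g (N ∸ℕ c ∸ℕ a)) ≈ f a * (h c * g (N ∸ℕ a ∸ℕ c))
    rearrange a c = begin
      h c * (f a * g (N ∸ℕ c ∸ℕ a)) ≈⟨ x∙yz≈y∙xz _ _ _ ⟩
      f a * (h c * g (N ∸ℕ c ∸ℕ a)) ≡⟨ cong (λ m → f a * (h c * g m)) ∸-swap ⟩
      f a * (h c * g (N ∸ℕ a ∸ℕ c)) ∎
      where
      ∸-swap : N ∸ℕ c ∸ℕ a ≡ N ∸ℕ a ∸ℕ c
      ∸-swap = ≡.trans (ℕ.∸-+-assoc N c a)
                 (≡.trans (cong (N ∸ℕ_) (ℕ.+-comm c a)) (≡.sym (ℕ.∸-+-assoc N a c)))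

  ⋆-commutativeMonoid : CommutativeMonoid c ℓ
  ⋆-commutativeMonoid = record
    { isCommutativeMonoid = record
      { isMonoid = record
        { isSemigroup = record
          { isMagma = record { isEquivalence = ≋-isEquivalence ; ∙-cong = ⋆-cong }
          ; assoc   = ⋆-assoc
          }
        ; identity = ⋆-identityˡ , ⋆-identityʳ
        }
      ; comm = ⋆-comm
      }
    }

  open CommutativeMonoid ⋆-commutativeMonoid public
    using () renaming (setoid to ≋-setoid; rawMonoid to ⋆-rawMonoid)
  open import Algebra.Properties.CommutativeSemigroup
    (CommutativeMonoid.commutativeSemigroup ⋆-commutativeMonoid) public
    using () renaming (interchange to ⋆-interchange; x∙yz≈y∙xz to ⋆-x∙yz≈y∙xz)
  open MonoidMorphisms ⋆-rawMonoid ⋆-rawMonoid public using (IsMonoidHomomorphism)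
  open Setoid ≋-setoid public using () renaming (refl to ≋-refl; trans to ≋-trans)
  module ≋-Reasoning = SetoidReasoning ≋-setoid

  ⋆-congˡ : ∀ f {g g′} → g ≋ g′ → f ⋆ g ≋ f ⋆ g′
  ⋆-congˡ f g≋g′ = ⋆-cong {f} ≋-refl g≋g′

  ⋆-congʳ : ∀ {f f′} g → f ≋ f′ → f ⋆ g ≋ f′ ⋆ g
  ⋆-congʳ g f≋f′ = ⋆-cong {g = g} f≋f′ ≋-refl

  ⋆-suc-degree≤1 : ∀ f g N → (∀ a → f (suc (suc a)) ≈ 0#) →
    (f ⋆ g) (suc N) ≈ f 0 * g (suc N) + f 1 * g N
  ⋆-suc-degree≤1 f g N f≈0 =
    trans (Σ≤-suc N _) (+-congˡ (Σ≤-head N _ (λ a _ → trans (*-congʳ (f≈0 a)) (zeroˡ _))))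

  ∏ : ∀ {n} → (Carrier → Series) → Vec Carrier n → Series
  ∏ F []       = one
  ∏ F (x ∷ xs) = F x ⋆ ∏ F xs

  ∏-cong : ∀ {F G} → (∀ x → F x ≋ G x) → ∀ {n} (xs : Vec Carrier n) → ∏ F xs ≋ ∏ G xs
  ∏-cong F≋G []       = ≋-refl
  ∏-cong F≋G (x ∷ xs) = ⋆-cong (F≋G x) (∏-cong F≋G xs)

  ∏-⋆ : ∀ F G {n} (xs : Vec Carrier n) → ∏ F xs ⋆ ∏ G xs ≋ ∏ (λ x → F x ⋆ G x) xs
  ∏-⋆ F G []       = ⋆-identityˡ one
  ∏-⋆ F G (x ∷ xs) =
    ≋-trans (⋆-interchange (F x) (∏ F xs) (G x) (∏ G xs)) (⋆-congˡ (F x ⋆ G x) (∏-⋆ F G xs))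

  ∏-map : ∀ F (g : Carrier → Carrier) {n} (xs : Vec Carrier n) → ∏ F (map g xs) ≡ ∏ (F ∘ g) xs
  ∏-map F g []       = ≡.refl
  ∏-map F g (x ∷ xs) = cong (F (g x) ⋆_) (∏-map F g xs)

  ∏-homo : ∀ {φ} → IsMonoidHomomorphism φ →
    ∀ F {n} (xs : Vec Carrier n) → φ (∏ F xs) ≋ ∏ (φ ∘ F) xs
  ∏-homo         φ-homo F []       = ε-homo
    where open IsMonoidHomomorphism φ-homo
  ∏-homo {φ = φ} φ-homo F (x ∷ xs) =
    ≋-trans (homo (F x) (∏ F xs)) (⋆-congˡ (φ (F x)) (∏-homo φ-homo F xs))
    where open IsMonoidHomomorphism φ-homo

  monomials : (ℕ → Bool) → Carrier → Series
  monomials P x a = if P a then pow x a else 0#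

  tupleSum-∏ : ∀ P {n} (xs : Vec Carrier n) → (λ m → tupleSum P m xs) ≋ ∏ (monomials P) xs
  tupleSum-∏ P []       .coeff zero    = refl
  tupleSum-∏ P []       .coeff (suc N) = refl
  tupleSum-∏ P (x ∷ xs) .coeff N       =
    Σ≤-cong N (λ a _ → guard-*ʳ (P a) (tupleSum-∏ P xs .coeff (N ∸ℕ a)))

  alternate : Series → Series
  alternate f N = signed N (f N)

  alternate-⋆-coeff : ∀ f g N → (alternate f ⋆ g) N ≈ Σ≤ N (λ j → signed j (f j * g (N ∸ℕ j)))
  alternate-⋆-coeff f g N = Σ≤-cong N (λ j _ → sym (signed-*ˡ j _ _))

  alternate-cong : ∀ {f g} → f ≋ g → alternate f ≋ alternate g
  alternate-cong f≋g .coeff N = signed-cong N (f≋g .coeff N)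

  alternate-one : alternate one ≋ one
  alternate-one .coeff zero    = refl
  alternate-one .coeff (suc N) = signed-0# (suc N)

  alternate-⋆ : ∀ f g → alternate (f ⋆ g) ≋ alternate f ⋆ alternate g
  alternate-⋆ f g .coeff N = trans (signed-Σ≤ N N _) (Σ≤-cong N (λ a a≤N → begin
    signed N (f a * g (N ∸ℕ a))
      ≡⟨ cong (λ m → signed m (f a * g (N ∸ℕ a))) (ℕ.m+[n∸m]≡n a≤N) ⟨
    signed (a +ℕ (N ∸ℕ a)) (f a * g (N ∸ℕ a))
      ≈⟨ signed-+ a (N ∸ℕ a) _ ⟩
    signed a (signed (N ∸ℕ a) (f a * g (N ∸ℕ a)))
      ≈⟨ signed-cong a (signed-*ʳ (N ∸ℕ a) _ _) ⟩
    signed a (f a * signed (N ∸ℕ a) (g (N ∸ℕ a)))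
      ≈⟨ signed-*ˡ a _ _ ⟩
    signed a (f a) * signed (N ∸ℕ a) (g (N ∸ℕ a)) ∎))

  alternate-isMonoidHomomorphism : IsMonoidHomomorphism alternate
  alternate-isMonoidHomomorphism = record
    { isMagmaHomomorphism = record
      { isRelHomomorphism = record { cong = alternate-cong }
      ; homo              = alternate-⋆
      }
    ; ε-homo = alternate-one
    }

module Dilation {c ℓ : Level} (R : CommutativeRing c ℓ) (s : ℕ) where
  open CommutativeRing R
  open Poly R
  open FiniteSums R
  open PowerSeries R
  open SetoidReasoning setoid

  dilate : Series → Series
  dilate f N = if N % suc s ≡ᵇ 0 then f (N / suc s) else 0#

  dilate-multiple : ∀ f K → dilate f (K *ℕ suc s) ≈ f K
  dilate-multiple f K rewrite m*n%n≡0 K (suc s) {{_}} | m*n/n≡m K (suc s) {{_}} = refl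

  dilate-nonmultiple : ∀ f {N} → ¬ suc s ∣ N → dilate f N ≈ 0#
  dilate-nonmultiple f {N} ∤N with N % suc s in eq
  ... | zero  = ⊥-elim (∤N (m%n≡0⇒n∣m N (suc s) eq))
  ... | suc _ = refl

  SupportedOnMultiples : (ℕ → Carrier) → Set ℓ
  SupportedOnMultiples F = ∀ b → ¬ suc s ∣ b → F b ≈ 0#

  Σ≤-block : ∀ {F} → SupportedOnMultiples F → ∀ q r → r ≤ s →
    Σ≤ (r +ℕ q *ℕ suc s) F ≈ Σ≤ q (λ j → F (j *ℕ suc s))
  Σ≤-block F≈0 zero    zero    _   = refl
  Σ≤-block F≈0 (suc q) zero    _   = +-congʳ (Σ≤-block F≈0 q s ℕ.≤-refl)
  Σ≤-block F≈0 q       (suc r) r<s =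
    trans (+-cong (Σ≤-block F≈0 q r (ℕ.<⇒≤ r<s)) (F≈0 _ ∤)) (+-identityʳ _)
    where
    ∤ : ¬ suc s ∣ suc r +ℕ q *ℕ suc s
    ∤ d∣ = ℕ.<⇒≱ (s≤s r<s)
      (∣⇒≤ (∣m+n∣m⇒∣n (≡.subst (suc s ∣_) (ℕ.+-comm (suc r) (q *ℕ suc s)) d∣) (n∣m*n q)))

  Σ≤-sparse : ∀ {F} → SupportedOnMultiples F → ∀ N →
    Σ≤ N F ≈ Σ≤ (N / suc s) (λ j → F (j *ℕ suc s))
  Σ≤-sparse {F} F≈0 N = trans
    (reflexive (cong (λ m → Σ≤ m F) (m≡m%n+[m/n]*n N (suc s))))
    (Σ≤-block F≈0 (N / suc s) (N % suc s) (ℕ.≤-pred (m%n<n N (suc s))))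

  dilate-⋆-coeff : ∀ f g N → (dilate f ⋆ g) N ≈ Σ≤ (N / suc s) (λ j → f j * g (N ∸ℕ j *ℕ suc s))
  dilate-⋆-coeff f g N = trans
    (Σ≤-sparse (λ b ∤b → trans (*-congʳ (dilate-nonmultiple f ∤b)) (zeroˡ _)) N)
    (Σ≤-cong (N / suc s) (λ j _ → *-congʳ (dilate-multiple f j)))

  dilate-cong : ∀ {f g} → f ≋ g → dilate f ≋ dilate g
  dilate-cong f≋g .coeff N with N % suc s ≡ᵇ 0
  ... | true  = f≋g .coeff (N / suc s)
  ... | false = refl

  dilate-one : dilate one ≋ one
  dilate-one .coeff N with suc s ∣? N
  ... | yes (divides K ≡.refl) = trans (dilate-multiple one K) (one-multiple K)
    where
    one-multiple : ∀ K → one K ≈ one (K *ℕ suc s)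
    one-multiple zero    = refl
    one-multiple (suc K) = refl
  ... | no ∤N = trans (dilate-nonmultiple one ∤N) (zero-nonmultiple N ∤N)
    where
    zero-nonmultiple : ∀ N → ¬ suc s ∣ N → 0# ≈ one N
    zero-nonmultiple zero    ∤0 = ⊥-elim (∤0 (divides 0 ≡.refl))
    zero-nonmultiple (suc N) _  = refl

  dilate-⋆ : ∀ f g → dilate (f ⋆ g) ≋ dilate f ⋆ dilate g
  dilate-⋆ f g .coeff N with suc s ∣? N
  ... | yes (divides K ≡.refl) = sym (begin
    (dilate f ⋆ dilate g) (K *ℕ suc s)
      ≈⟨ dilate-⋆-coeff f (dilate g) (K *ℕ suc s) ⟩
    Σ≤ (K *ℕ suc s / suc s) (λ j → f j * dilate g (K *ℕ suc s ∸ℕ j *ℕ suc s))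
      ≡⟨ cong (λ m → Σ≤ m (λ j → f j * dilate g (K *ℕ suc s ∸ℕ j *ℕ suc s))) (m*n/n≡m K (suc s)) ⟩
    Σ≤ K (λ j → f j * dilate g (K *ℕ suc s ∸ℕ j *ℕ suc s))
      ≈⟨ Σ≤-cong K (λ j _ → *-congˡ (trans
           (reflexive (cong (dilate g) (≡.sym (ℕ.*-distribʳ-∸ (suc s) K j))))
           (dilate-multiple g (K ∸ℕ j)))) ⟩
    (f ⋆ g) K
      ≈⟨ dilate-multiple (f ⋆ g) K ⟨
    dilate (f ⋆ g) (K *ℕ suc s) ∎)
  ... | no ∤N = trans (dilate-nonmultiple (f ⋆ g) ∤N) (sym (Σ≤-zero N term≈0))
    where
    term≈0 : ∀ b → b ≤ N → dilate f b * dilate g (N ∸ℕ b) ≈ 0#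
    term≈0 b b≤N with suc s ∣? b
    ... | no ∤b   = trans (*-congʳ (dilate-nonmultiple f ∤b)) (zeroˡ _)
    ... | yes d∣b = trans (*-congˡ (dilate-nonmultiple g ∤N∸b)) (zeroʳ _)
      where
      ∤N∸b : ¬ suc s ∣ N ∸ℕ b
      ∤N∸b d∣N∸b = ∤N (≡.subst (suc s ∣_) (ℕ.m+[n∸m]≡n b≤N) (∣m∣n⇒∣m+n d∣b d∣N∸b))

  dilate-isMonoidHomomorphism : IsMonoidHomomorphism dilate
  dilate-isMonoidHomomorphism = record
    { isMagmaHomomorphism = record
      { isRelHomomorphism = record { cong = dilate-cong }
      ; homo              = dilate-⋆
      }
    ; ε-homo = dilate-one
    }

module GeneratingFunctions {c ℓ : Level} (R : CommutativeRing c ℓ) (s : ℕ) where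
  open CommutativeRing R
  open Poly R
  open Signs R
  open PowerSeries R
  open Dilation R s
  open Powers R
  open Guards R
  open import Algebra.Properties.Ring ring using (-‿distribˡ-*)
  module ≈-Reasoning = SetoidReasoning setoid

  hSeries eSeries MSeries : ∀ {n} → Vec Carrier n → Series
  hSeries xs j = h j xs
  eSeries xs j = e j xs
  MSeries xs m = M s m xs

  linear : Carrier → Series
  linear = monomials (_≤ᵇ 1)

  residue₀₁ : ℕ → Bool
  residue₀₁ a = (a % suc s ≡ᵇ 0) ∨ (a % suc s ≡ᵇ 1)

  dilate-pow : ∀ x N → dilate (pow (pow x (suc s))) N ≈ (if N % suc s ≡ᵇ 0 then pow x N else 0#)
  dilate-pow x N with N % suc s in eq
  ... | zero  = trans (pow-pow x (suc s) (N / suc s)) (reflexive (cong (pow x) (≡.sym N≡)))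
    where
    N≡ : N ≡ N / suc s *ℕ suc s
    N≡ = ≡.trans (m≡m%n+[m/n]*n N (suc s)) (cong (_+ℕ N / suc s *ℕ suc s) eq)
  ... | suc _ = refl

  -- False for s = 0, where every residue is 0.
  suc-residue≡1 : 1 ≤ s → ∀ N → (suc N % suc s ≡ᵇ 1) ≡ (N % suc s ≡ᵇ 0)
  suc-residue≡1 1≤s N =
    ≡.trans (cong (_≡ᵇ 1) suc-%) (from-residue (N % suc s) (m%n<n N (suc s)))
    where
    suc-% : suc N % suc s ≡ suc (N % suc s) % suc s
    suc-% = ≡.trans (%-distribˡ-+ 1 N (suc s))
                    (cong (λ m → (m +ℕ N % suc s) % suc s) (m<n⇒m%n≡m (s≤s 1≤s)))

    from-residue : ∀ t → t < suc s → (suc t % suc s ≡ᵇ 1) ≡ (t ≡ᵇ 0)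
    from-residue zero    _   = cong (_≡ᵇ 1) (m<n⇒m%n≡m (s≤s 1≤s))
    from-residue (suc t) t<d with suc t ℕ.≟ s
    ... | yes t+1≡s = cong (_≡ᵇ 1) (≡.trans (cong (λ m → suc m % suc s) t+1≡s) (n%n≡0 (suc s)))
    ... | no  t+1≢s = cong (_≡ᵇ 1) (m<n⇒m%n≡m (s≤s (ℕ.≤∧≢⇒< (ℕ.≤-pred t<d) t+1≢s)))

  M-factor : 1 ≤ s → ∀ x → monomials residue₀₁ x ≋ linear x ⋆ dilate (pow (pow x (suc s)))
  M-factor 1≤s x .coeff zero    = sym (*-identityˡ 1#)
  M-factor 1≤s x .coeff (suc N) = begin
    monomials residue₀₁ x (suc N)
      ≈⟨ guard-∨ (suc N % suc s) (pow x (suc N)) ⟩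
    (if suc N % suc s ≡ᵇ 0 then pow x (suc N) else 0#) + (if suc N % suc s ≡ᵇ 1 then pow x (suc N) else 0#)
      ≡⟨ cong (λ b → (if suc N % suc s ≡ᵇ 0 then pow x (suc N) else 0#) + (if b then pow x (suc N) else 0#))
              (suc-residue≡1 1≤s N) ⟩
    (if suc N % suc s ≡ᵇ 0 then pow x (suc N) else 0#) + (if N % suc s ≡ᵇ 0 then x * pow x N else 0#)
      ≈⟨ +-cong (dilate-pow x (suc N))
                (trans (*-congˡ (dilate-pow x N)) (*-guard (N % suc s ≡ᵇ 0) x (pow x N))) ⟨
    Z (suc N) + x * Z N
      ≈⟨ +-cong (*-identityˡ _) (*-congʳ (*-identityʳ x)) ⟨
    linear x 0 * Z (suc N) + linear x 1 * Z N
      ≈⟨ ⋆-suc-degree≤1 (linear x) Z N (λ _ → refl) ⟨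
    (linear x ⋆ Z) (suc N) ∎
    where
    open ≈-Reasoning
    Z : Series
    Z = dilate (pow (pow x (suc s)))

  alternate-pow⋆linear : ∀ x → alternate (pow x) ⋆ linear x ≋ one
  alternate-pow⋆linear x .coeff zero    = *-identityˡ 1#
  alternate-pow⋆linear x .coeff (suc N) = begin
    (alternate (pow x) ⋆ linear x) (suc N)
      ≈⟨ ⋆-comm (alternate (pow x)) (linear x) .coeff (suc N) ⟩
    (linear x ⋆ alternate (pow x)) (suc N)
      ≈⟨ ⋆-suc-degree≤1 (linear x) (alternate (pow x)) N (λ _ → refl) ⟩
    1# * - signed N (x * pow x N) + (x * 1#) * signed N (pow x N)
      ≈⟨ +-cong (trans (*-identityˡ _) (-‿cong (signed-*ʳ N x _))) (*-congʳ (*-identityʳ x)) ⟩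
    - (x * signed N (pow x N)) + x * signed N (pow x N)
      ≈⟨ -‿inverseˡ _ ⟩
    0# ∎
    where open ≈-Reasoning

  alternate-linear⋆pow : ∀ x → alternate (linear x) ⋆ pow x ≋ one
  alternate-linear⋆pow x .coeff zero    = *-identityˡ 1#
  alternate-linear⋆pow x .coeff (suc N) = begin
    (alternate (linear x) ⋆ pow x) (suc N)
      ≈⟨ ⋆-suc-degree≤1 (alternate (linear x)) (pow x) N (λ a → signed-0# (suc (suc a))) ⟩
    1# * (x * pow x N) + - (x * 1#) * pow x N
      ≈⟨ +-cong (*-identityˡ _) (trans (sym (-‿distribˡ-* _ _)) (-‿cong (*-congʳ (*-identityʳ x)))) ⟩
    x * pow x N + - (x * pow x N)
      ≈⟨ -‿inverseʳ _ ⟩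
    0# ∎
    where open ≈-Reasoning

  alternate-pow⋆M-factor : 1 ≤ s → ∀ x →
    alternate (pow x) ⋆ monomials residue₀₁ x ≋ dilate (pow (pow x (suc s)))
  alternate-pow⋆M-factor 1≤s x = begin
    alternate (pow x) ⋆ monomials residue₀₁ x  ≈⟨ ⋆-congˡ (alternate (pow x)) (M-factor 1≤s x) ⟩
    alternate (pow x) ⋆ (linear x ⋆ Z)        ≈⟨ ⋆-assoc (alternate (pow x)) (linear x) Z ⟨
    (alternate (pow x) ⋆ linear x) ⋆ Z        ≈⟨ ⋆-congʳ Z (alternate-pow⋆linear x) ⟩
    one ⋆ Z                                   ≈⟨ ⋆-identityˡ Z ⟩
    Z                                         ∎
    where
    open ≋-Reasoning
    Z : Series
    Z = dilate (pow (pow x (suc s)))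

  dilate-alternate-linear⋆M-factor : 1 ≤ s → ∀ x →
    dilate (alternate (linear (pow x (suc s)))) ⋆ monomials residue₀₁ x ≋ linear x
  dilate-alternate-linear⋆M-factor 1≤s x = begin
    W ⋆ monomials residue₀₁ x
      ≈⟨ ⋆-congˡ W (M-factor 1≤s x) ⟩
    W ⋆ (linear x ⋆ dilate (pow y))
      ≈⟨ ⋆-x∙yz≈y∙xz W (linear x) (dilate (pow y)) ⟩
    linear x ⋆ (W ⋆ dilate (pow y))
      ≈⟨ ⋆-congˡ (linear x) (dilate-⋆ (alternate (linear y)) (pow y)) ⟨
    linear x ⋆ dilate (alternate (linear y) ⋆ pow y)
      ≈⟨ ⋆-congˡ (linear x) (≋-trans (dilate-cong (alternate-linear⋆pow y)) dilate-one) ⟩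
    linear x ⋆ one
      ≈⟨ ⋆-identityʳ (linear x) ⟩
    linear x ∎
    where
    open ≋-Reasoning
    y : Carrier
    y = pow x (suc s)
    W : Series
    W = dilate (alternate (linear y))

  h-identity : 1 ≤ s → ∀ {n} (xs : Vec Carrier n) →
    alternate (hSeries xs) ⋆ MSeries xs ≋ dilate (hSeries (powVec s xs))
  h-identity 1≤s xs = begin
    alternate (hSeries xs) ⋆ MSeries xs
      ≈⟨ ⋆-cong (alternate-cong (tupleSum-∏ _ xs)) (tupleSum-∏ _ xs) ⟩
    alternate (∏ pow xs) ⋆ ∏ (monomials residue₀₁) xs
      ≈⟨ ⋆-congʳ (∏ (monomials residue₀₁) xs) (∏-homo alternate-isMonoidHomomorphism pow xs) ⟩
    ∏ (alternate ∘ pow) xs ⋆ ∏ (monomials residue₀₁) xs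
      ≈⟨ ∏-⋆ (alternate ∘ pow) (monomials residue₀₁) xs ⟩
    ∏ (λ x → alternate (pow x) ⋆ monomials residue₀₁ x) xs
      ≈⟨ ∏-cong (alternate-pow⋆M-factor 1≤s) xs ⟩
    ∏ (λ x → dilate (pow (pow x (suc s)))) xs
      ≡⟨ ∏-map (dilate ∘ pow) (λ x → pow x (suc s)) xs ⟨
    ∏ (dilate ∘ pow) (powVec s xs)
      ≈⟨ ∏-homo dilate-isMonoidHomomorphism pow (powVec s xs) ⟨
    dilate (∏ pow (powVec s xs))
      ≈⟨ dilate-cong (tupleSum-∏ _ (powVec s xs)) ⟨
    dilate (hSeries (powVec s xs)) ∎
    where open ≋-Reasoning

  e-identity : 1 ≤ s → ∀ {n} (xs : Vec Carrier n) →
    dilate (alternate (eSeries (powVec s xs))) ⋆ MSeries xs ≋ eSeries xs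
  e-identity 1≤s xs = begin
    dilate (alternate (eSeries (powVec s xs))) ⋆ MSeries xs
      ≈⟨ ⋆-cong (dilate-cong (alternate-cong (tupleSum-∏ _ (powVec s xs)))) (tupleSum-∏ _ xs) ⟩
    dilate (alternate (∏ linear (powVec s xs))) ⋆ ∏ (monomials residue₀₁) xs
      ≡⟨ cong (λ P → dilate (alternate P) ⋆ ∏ (monomials residue₀₁) xs)
              (∏-map linear (λ x → pow x (suc s)) xs) ⟩
    dilate (alternate (∏ (λ x → linear (pow x (suc s))) xs)) ⋆ ∏ (monomials residue₀₁) xs
      ≈⟨ ⋆-congʳ (∏ (monomials residue₀₁) xs)
           (≋-trans (dilate-cong (∏-homo alternate-isMonoidHomomorphism _ xs))
                    (∏-homo dilate-isMonoidHomomorphism _ xs)) ⟩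
    ∏ W xs ⋆ ∏ (monomials residue₀₁) xs
      ≈⟨ ∏-⋆ W (monomials residue₀₁) xs ⟩
    ∏ (λ x → W x ⋆ monomials residue₀₁ x) xs
      ≈⟨ ∏-cong (dilate-alternate-linear⋆M-factor 1≤s) xs ⟩
    ∏ linear xs
      ≈⟨ tupleSum-∏ _ xs ⟨
    eSeries xs ∎
    where
    open ≋-Reasoning
    W : Carrier → Series
    W x = dilate (alternate (linear (pow x (suc s))))

theorem5p3 : ∀ {c ℓ : Level} (R : CommutativeRing c ℓ) (k n s : ℕ) →
    1 ≤ k → 1 ≤ n → 1 ≤ s → (xs : Vec (CommutativeRing.Carrier R) n) →
    let open CommutativeRing R in
    let open Poly R in
    (h k (powVec s xs) ≈ Σ≤ (k *ℕ suc s) (λ j → signed j (h j xs * M s (k *ℕ suc s ∸ℕ j) xs)))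
    × (e k xs ≈ Σ≤ (k / suc s) (λ j → signed j (e j (powVec s xs) * M s (k ∸ℕ j *ℕ suc s) xs)))
    × (¬ (k % suc s ≡ 0) → Σ≤ k (λ j → signed j (h j xs * M s (k ∸ℕ j) xs)) ≈ 0#)
-- The identities hold for all k and n; only s ≥ 1 is needed.
theorem5p3 R k n s _ _ 1≤s xs =
  (begin
    h k ys                                              ≈⟨ dilate-multiple (hSeries ys) k ⟨
    dilate (hSeries ys) (k *ℕ suc s)                    ≈⟨ h-identity 1≤s xs .coeff (k *ℕ suc s) ⟨
    (alternate (hSeries xs) ⋆ MSeries xs) (k *ℕ suc s)  ≈⟨ alternate-⋆-coeff (hSeries xs) (MSeries xs) (k *ℕ suc s) ⟩
    _                                                   ∎) ,
  (begin
    e k xs                                              ≈⟨ e-identity 1≤s xs .coeff k ⟨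
    (dilate (alternate (eSeries ys)) ⋆ MSeries xs) k    ≈⟨ dilate-⋆-coeff (alternate (eSeries ys)) (MSeries xs) k ⟩
    Σ≤ (k / suc s) (λ j → signed j (e j ys) * M s (k ∸ℕ j *ℕ suc s) xs)
                                                        ≈⟨ Σ≤-cong (k / suc s) (λ j _ → signed-*ˡ j _ _) ⟨
    _                                                   ∎) ,
  λ k%≢0 → begin
    _                                                   ≈⟨ alternate-⋆-coeff (hSeries xs) (MSeries xs) k ⟨
    (alternate (hSeries xs) ⋆ MSeries xs) k             ≈⟨ h-identity 1≤s xs .coeff k ⟩
    dilate (hSeries ys) k                               ≈⟨ dilate-nonmultiple (hSeries ys) (∤k k%≢0) ⟩
    0#                                                  ∎
  where
  open CommutativeRing R
  open Poly R
  open FiniteSums R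
  open Signs R
  open PowerSeries R
  open Dilation R s
  open GeneratingFunctions R s
  open SetoidReasoning setoid

  ys : Vec Carrier n
  ys = powVec s xs

  ∤k : ¬ (k % suc s ≡ 0) → ¬ suc s ∣ k
  ∤k k%≢0 = k%≢0 ∘ n∣m⇒m%n≡0 k (suc s)
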